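{- For every graph $G$ on $n$ vertices and every positive integer $l$, $h(G,l)\le ca(G,l)\le \min(l,n)\cdot h(G,l)$.
   Context: Graphs are finite, undirected, with no parallel edges and no isolated vertices. For $A\subseteq V(G)$, $N(A)$ is the set of vertices with a neighbor in $A$. Given $W_1,\dots,W_l\subseteq V$, the rabbit territory is $R_1=V\setminus W_1$, $R_t=N(R_{t-1})\setminus W_t$ for $t\ge2$; $h(G,l)$ is the minimum $k$ such that there exist $W_1,\dots,W_l$ with $|W_t|\le k$ for all $t$ and $R_l=\emptyset$. The layered digraph $L(G,l)$ has vertex set $\{v^i: v\in V,\ i\in[l]\}\cup\{s,t\}$ and arc set $\{(u^i,v^{i+1}),(v^i,u^{i+1}): uv\in E,\ i\in[l-1]\}\cup\{(s,v^1),(v^l,t): v\in V\}$. $ca(G,l)$ is the minimum size of an $s$–$t$ vertex cut in $L(G,l)$, i.e., the minimum number of vertices other than $s,t$ whose removal destroys all directed $s$–$t$ paths. -}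

module Defs where

open import Data.Nat using (ℕ; zero; suc; _≤_; _⊓_; _*_)
open import Data.Bool using (Bool; true; false)
open import Data.Fin using (Fin; toℕ)
open import Data.Fin.Subset using (Subset; _∈_; _∉_; ∣_∣)
open import Data.Vec using (sum; tabulate)
open import Data.Product using (Σ; ∃; _×_)
open import Data.Empty using (⊥)
open import Relation.Nullary using (¬_)
open import Relation.Binary.PropositionalEquality using (_≡_)

record Graph (n : ℕ) : Set where
  field
    adj        : Fin n → Fin n → Bool
    adj-sym    : ∀ u v → adj u v ≡ adj v u
    adj-irrefl : ∀ v → adj v v ≡ false
    no-isolated : ∀ v → ∃ λ u → adj v u ≡ true

module _ {n : ℕ} (G : Graph n) where
  open Graph G

  Adj : Fin n → Fin n → Set
  Adj u v = adj u v ≡ true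

  InN : (Fin n → Set) → Fin n → Set
  InN A v = ∃ λ u → A u × Adj u v

  -- Rabbit territory R_t for hunter sets W_1, W_2, … (indexed from 1;
  -- W 0 is never used).  R_1 = V ∖ W_1, R_{t} = N(R_{t-1}) ∖ W_t.
  Territory : (ℕ → Subset n) → ℕ → Fin n → Set
  Territory W zero v = ⊥
  Territory W (suc zero) v = v ∉ W 1
  Territory W (suc (suc t)) v = InN (Territory W (suc t)) v × v ∉ W (suc (suc t))

  HunterWins : ℕ → ℕ → Set
  HunterWins l k = Σ (ℕ → Subset n) λ W →
    (∀ t → 1 ≤ t → t ≤ l → ∣ W t ∣ ≤ k) × (∀ v → ¬ Territory W l v)

  -- The layered digraph L(G,l).  Layer index i : Fin l represents layer toℕ i + 1.
  data LVert (l : ℕ) : Set where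
    src : LVert l
    snk : LVert l
    lay : Fin n → Fin l → LVert l

  data Arc (l : ℕ) : LVert l → LVert l → Set where
    s-arc : ∀ v (i : Fin l) → toℕ i ≡ 0 → Arc l src (lay v i)
    t-arc : ∀ v (i : Fin l) → suc (toℕ i) ≡ l → Arc l (lay v i) snk
    e-arc : ∀ u v (i j : Fin l) → Adj u v → suc (toℕ i) ≡ toℕ j →
            Arc l (lay u i) (lay v j)

  -- A vertex set removed from L(G,l) (excluding s, t), given layer by layer.
  Cut : ℕ → Set
  Cut l = Fin l → Subset n

  cutSize : ∀ {l} → Cut l → ℕ
  cutSize {l} C = sum (tabulate (λ i → ∣ C i ∣))

  Removed : ∀ {l} → Cut l → LVert l → Set
  Removed C src = ⊥
  Removed C snk = ⊥
  Removed C (lay v i) = v ∈ C i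

  -- Directed walks in L(G,l) - C (every vertex after the start avoids C).
  data Walk {l : ℕ} (C : Cut l) : LVert l → LVert l → Set where
    []  : ∀ {x} → Walk C x x
    _∷_ : ∀ {x y z} → Arc l x y → ¬ Removed C y → Walk C y z → Walk C x z

  CutWins : ℕ → ℕ → Set
  CutWins l k = Σ (Cut l) λ C → cutSize C ≤ k × ¬ Walk C src snk

IsLeast : (ℕ → Set) → ℕ → Set
IsLeast P k = P k × (∀ m → P m → k ≤ m)

IsH : ∀ {n} → Graph n → ℕ → ℕ → Set
IsH G l = IsLeast (HunterWins G l)

IsCA : ∀ {n} → Graph n → ℕ → ℕ → Set
IsCA G l = IsLeast (CutWins G l)

{-# OPTIONS --safe #-}
module Submission where

-- A cut C of L(G,l) is used as the hunter strategy W_t = (layer t of C):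
-- every rabbit position at round t is then the endpoint of a C-avoiding
-- path from s to layer t, so a territory that is empty after l rounds means
-- there is no s–t path, and h ≤ ca.  Conversely the rounds of a winning
-- hunter strategy, placed in the corresponding layers, form a cut of size
-- at most l·h, because a path avoiding it is a rabbit trajectory surviving
-- to round l.  Finally the whole first layer is a cut of size n, and h ≥ 1
-- as soon as n ≥ 1: with no isolated vertices an unhunted rabbit can always
-- move.  Hence ca ≤ min(l·h, n·h).

open import Defs
open import Data.Nat using (ℕ; _≤_; _⊓_; _*_)
open import Data.Product using (_×_)

open import Data.Nat using (zero; suc; _+_; _<_; _<?_; z≤n; s≤s)
open import Data.Nat.Properties
  using (≤-refl; ≤-trans; ≤-reflexive; n≤1+n; n<1+n; n≮0; m≤m+n; m≤n+m; +-mono-≤;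
         +-identityʳ; *-zeroʳ; m≤m*n; ⊓-glb; *-distribʳ-⊓; module ≤-Reasoning)
open import Data.Fin using (Fin; toℕ; fromℕ<) renaming (zero to fzero; suc to fsuc)
open import Data.Fin.Properties using (toℕ<n; toℕ-fromℕ<)
open import Data.Fin.Subset using (Subset; _∉_; ∣_∣; ⊤; ⊥)
open import Data.Fin.Subset.Properties using (∈⊤; ∣p∣≤n; ∣⊥∣≡0; x∈p⇒∣p-x∣<∣p∣)
open import Data.Vec using (sum; tabulate)
open import Data.Product using (∃; _,_)
open import Data.Empty using (⊥-elim)
open import Relation.Nullary using (¬_; yes; no)
open import Relation.Binary.PropositionalEquality using (_≡_; refl; sym; trans; subst; cong)

sum-tabulate-≤ : ∀ {l} (f : Fin l → ℕ) k → (∀ i → f i ≤ k) → sum (tabulate f) ≤ l * k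
sum-tabulate-≤ {zero}  f k f≤k = z≤n
sum-tabulate-≤ {suc l} f k f≤k =
  +-mono-≤ (f≤k fzero) (sum-tabulate-≤ (λ i → f (fsuc i)) k (λ i → f≤k (fsuc i)))

lookup≤sum-tabulate : ∀ {l} (f : Fin l → ℕ) i → f i ≤ sum (tabulate f)
lookup≤sum-tabulate f fzero    = m≤m+n _ _
lookup≤sum-tabulate f (fsuc i) =
  ≤-trans (lookup≤sum-tabulate (λ j → f (fsuc j)) i) (m≤n+m _ _)

∣p∣≤0⇒x∉p : ∀ {n} {x : Fin n} (p : Subset n) → ∣ p ∣ ≤ 0 → x ∉ p
∣p∣≤0⇒x∉p p ∣p∣≤0 x∈p = n≮0 (≤-trans (x∈p⇒∣p-x∣<∣p∣ x∈p) ∣p∣≤0)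

module _ {n : ℕ} (G : Graph n) where
  open Graph G

  Walk-snoc : ∀ {l} {C : Cut G l} {x y z} →
              Walk G C x y → Arc G l y z → ¬ Removed G C z → Walk G C x z
  Walk-snoc []               a′ a′-ok = _∷_ a′ a′-ok []
  Walk-snoc (_∷_ a a-ok w) a′ a′-ok = _∷_ a a-ok (Walk-snoc w a′ a′-ok)

  module FromCut {l : ℕ} (C : Cut G l) where

    -- Round t+1 is played on layer t; rounds beyond l get no hunters.
    schedule : ℕ → Subset n
    schedule zero    = ⊥
    schedule (suc t) with t <? l
    ... | yes t<l = C (fromℕ< t<l)
    ... | no  _   = ⊥

    schedule-layer : ∀ t (t<l : t < l) → schedule (suc t) ≡ C (fromℕ< t<l)
    schedule-layer t t<l with t <? l
    ... | yes _   = refl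
    ... | no  t≮l = ⊥-elim (t≮l t<l)

    ∣schedule∣≤cutSize : ∀ t → ∣ schedule (suc t) ∣ ≤ cutSize G C
    ∣schedule∣≤cutSize t with t <? l
    ... | yes t<l = lookup≤sum-tabulate (λ i → ∣ C i ∣) (fromℕ< t<l)
    ... | no  _   = subst (_≤ cutSize G C) (sym (∣⊥∣≡0 n)) z≤n

    territory⇒walk : ∀ t (t<l : t < l) {v} →
                     Territory G schedule (suc t) v → Walk G C src (lay v (fromℕ< t<l))
    territory⇒walk zero t<l {v} v∉W =
      _∷_ (s-arc v _ (toℕ-fromℕ< t<l)) (subst (v ∉_) (schedule-layer 0 t<l) v∉W) []
    territory⇒walk (suc t) t+1<l {v} ((u , u∈R , uv) , v∉W) =
      Walk-snoc (territory⇒walk t t<l u∈R)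
        (e-arc u v _ _ uv (trans (cong suc (toℕ-fromℕ< t<l)) (sym (toℕ-fromℕ< t+1<l))))
        (subst (v ∉_) (schedule-layer (suc t) t+1<l) v∉W)
      where
        t<l : t < l
        t<l = ≤-trans (n≤1+n _) t+1<l

  cutWins⇒hunterWins : ∀ {L k} → CutWins G (suc L) k → HunterWins G (suc L) k
  cutWins⇒hunterWins {L} {k} (C , ∣C∣≤k , no-walk) = schedule , bounded , cleared
    where
      open FromCut C

      bounded : ∀ t → 1 ≤ t → t ≤ suc L → ∣ schedule t ∣ ≤ k
      bounded (suc t) _ _ = ≤-trans (∣schedule∣≤cutSize t) ∣C∣≤k

      cleared : ∀ v → ¬ Territory G schedule (suc L) v
      cleared v v∈R = no-walk
        (Walk-snoc (territory⇒walk L (n<1+n L) v∈R)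
          (t-arc v _ (cong suc (toℕ-fromℕ< (n<1+n L)))) (λ ()))

  module FromHunters {l : ℕ} (W : ℕ → Subset n) where

    layers : Cut G l
    layers i = W (suc (toℕ i))

    walk⇒territory : ∀ {v i} → Territory G W (suc (toℕ i)) v →
                     Walk G layers (lay v i) snk → ∃ (Territory G W l)
    walk⇒territory {v} v∈R (_∷_ (t-arc _ _ i+1≡l) _ _) =
      v , subst (λ t → Territory G W t v) i+1≡l v∈R
    walk⇒territory {v} v∈R (_∷_ (e-arc _ w _ _ vw i+1≡j) w∉C rest) =
      walk⇒territory
        (subst (λ t → Territory G W (suc t) w) i+1≡j
          ((v , v∈R , vw) , subst (λ t → w ∉ W (suc t)) (sym i+1≡j) w∉C))
        rest

    src-walk⇒territory : Walk G layers src snk → ∃ (Territory G W l)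
    src-walk⇒territory (_∷_ (s-arc v _ i≡0) v∉C rest) =
      walk⇒territory
        (subst (λ t → Territory G W (suc t) v) (sym i≡0) (subst (λ t → v ∉ W (suc t)) i≡0 v∉C))
        rest

  hunterWins⇒cutWins : ∀ {l k} → HunterWins G l k → CutWins G l (l * k)
  hunterWins⇒cutWins {l} {k} (W , bounded , cleared) =
    layers , ∣layers∣≤l*k , λ walk → let (v , v∈R) = src-walk⇒territory walk in cleared v v∈R
    where
      open FromHunters {l} W

      ∣layers∣≤l*k : cutSize G layers ≤ l * k
      ∣layers∣≤l*k = sum-tabulate-≤ _ k (λ i → bounded (suc (toℕ i)) (s≤s z≤n) (toℕ<n i))

  firstLayer : ∀ {L} → Cut G (suc L)
  firstLayer fzero    = ⊤
  firstLayer (fsuc _) = ⊥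

  firstLayer-cutWins : ∀ L → CutWins G (suc L) n
  firstLayer-cutWins L = firstLayer , ∣firstLayer∣≤n , blocked
    where
      blocked : ¬ Walk G firstLayer src snk
      blocked (_∷_ (s-arc _ fzero    _)  v∉⊤ _) = v∉⊤ ∈⊤
      blocked (_∷_ (s-arc _ (fsuc _) ()) _   _)

      open ≤-Reasoning
      ∣firstLayer∣≤n : cutSize G (firstLayer {L}) ≤ n
      ∣firstLayer∣≤n = begin
        ∣ ⊤ {n} ∣ + sum (tabulate (λ (_ : Fin L) → ∣ ⊥ {n} ∣))
          ≤⟨ +-mono-≤ (∣p∣≤n ⊤) (sum-tabulate-≤ {L} _ 0 (λ _ → ≤-reflexive (∣⊥∣≡0 n))) ⟩
        n + L * 0
          ≡⟨ trans (cong (n +_) (*-zeroʳ L)) (+-identityʳ n) ⟩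
        n ∎

  unhunted⇒territory-full : ∀ {l} (W : ℕ → Subset n) → (∀ t → 1 ≤ t → t ≤ l → ∣ W t ∣ ≤ 0) →
                            ∀ t → suc t ≤ l → ∀ v → Territory G W (suc t) v
  unhunted⇒territory-full W none zero    t<l v = ∣p∣≤0⇒x∉p (W 1) (none 1 (s≤s z≤n) t<l)
  unhunted⇒territory-full W none (suc t) t<l v with no-isolated v
  ... | u , vu =
    (u , unhunted⇒territory-full W none t (≤-trans (n≤1+n _) t<l) u , trans (adj-sym u v) vu) ,
    ∣p∣≤0⇒x∉p (W (suc (suc t))) (none (suc (suc t)) (s≤s z≤n) t<l)

  ¬hunterWins-0 : ∀ {L} → Fin n → ¬ HunterWins G (suc L) 0
  ¬hunterWins-0 {L} v (W , none , cleared) =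
    cleared v (unhunted⇒territory-full W none L ≤-refl v)

hunterWins⇒n≤n*k : ∀ {n} (G : Graph n) {L k} → HunterWins G (suc L) k → n ≤ n * k
hunterWins⇒n≤n*k {zero}  G             _  = z≤n
hunterWins⇒n≤n*k {suc m} G {k = zero}  hw = ⊥-elim (¬hunterWins-0 G fzero hw)
hunterWins⇒n≤n*k {suc m} G {k = suc k} _  = m≤m*n (suc m) (suc k)

proposition6 : ∀ {n} (G : Graph n) (l : ℕ) → 1 ≤ l → ∀ h c →
    IsH G l h → IsCA G l c → h ≤ c × c ≤ (l ⊓ n) * h
proposition6 {n} G (suc L) _ h c (hunters , h-least) (cut , c-least) =
  h-least c (cutWins⇒hunterWins G cut) , c≤min*h
  where
    open ≤-Reasoning
    c≤min*h : c ≤ (suc L ⊓ n) * h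
    c≤min*h = begin
      c                    ≤⟨ ⊓-glb (c-least _ (hunterWins⇒cutWins G hunters))
                                    (≤-trans (c-least n (firstLayer-cutWins G L)) (hunterWins⇒n≤n*k G hunters)) ⟩
      suc L * h ⊓ (n * h)  ≡⟨ *-distribʳ-⊓ h (suc L) n ⟨
      (suc L ⊓ n) * h      ∎
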